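{- Let $\lambda,\mu,\nu\vdash n$ with $\ell(\lambda)=\ell$, $\ell(\mu)=m$, $\ell(\nu)=r$. Then $$g(\lambda,\mu,\nu)\;\le\;\left(1+\frac{\ell m r}{n}\right)^{n}\left(1+\frac{\ell m}{n}\right)^{n}\left(1+\frac{n}{\ell m r}\right)^{\ell m r}\left(1+\frac{n}{\ell m}\right)^{\ell m}.$$
   Context: $\ell(\lambda)$ is the number of parts of $\lambda$. The Kronecker coefficient is $g(\lambda,\mu,\nu)=\frac{1}{n!}\sum_{\sigma\in S_n}\chi^\lambda(\sigma)\chi^\mu(\sigma)\chi^\nu(\sigma)$, with $\chi^\lambda$ the irreducible $S_n$-character indexed by $\lambda$. -}

module Defs where

open import Data.Bool using (Bool; true; false; if_then_else_; _∧_)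
import Data.Bool
open import Data.Nat as ℕ using (ℕ; zero; suc; _≡ᵇ_; _<ᵇ_; _≤ᵇ_; _∸_; _≥_; _>_)
open import Data.Integer as ℤ using (ℤ)
open import Data.List using (List; []; _∷_; length; map; foldr; upTo; concatMap; filterᵇ)
open import Data.Bool.ListAction using (all; any)
open import Data.Nat.ListAction using (sum)
open import Data.List.Relation.Unary.All using (All)
open import Data.List.Relation.Unary.Linked using (Linked)
open import Relation.Binary.PropositionalEquality using (_≡_)

record IsPartition (n : ℕ) (λ' : List ℕ) : Set where
  field
    decreasing : Linked _≥_ λ'
    positive   : All (_> 0) λ'
    size       : sum λ' ≡ n

len : List ℕ → ℕ
len = length

-- The symmetric group S_n, enumerated: a permutation σ of {0,…,n-1} is
-- the list [σ(0), …, σ(n-1)].  perms n lists each element of S_n once.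

insertions : ℕ → List ℕ → List (List ℕ)
insertions x []       = (x ∷ []) ∷ []
insertions x (y ∷ ys) = (x ∷ y ∷ ys) ∷ map (y ∷_) (insertions x ys)

perms : ℕ → List (List ℕ)
perms zero    = [] ∷ []
perms (suc n) = concatMap (insertions n) (perms n)

-- application σ(i) (default 0 out of range, never used)
app : List ℕ → ℕ → ℕ
app []       i       = 0
app (x ∷ xs) zero    = x
app (x ∷ xs) (suc i) = app xs i

iter : List ℕ → ℕ → ℕ → ℕ
iter σ zero    i = i
iter σ (suc k) i = app σ (iter σ k i)

firstᵇ : (ℕ → Bool) → List ℕ → ℕ
firstᵇ p []       = 0
firstᵇ p (x ∷ xs) = if p x then x else firstᵇ p xs

orbitLen : ℕ → List ℕ → ℕ → ℕ
orbitLen n σ i = firstᵇ (λ k → iter σ k i ≡ᵇ i) (map suc (upTo n))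

isCycleMin : ℕ → List ℕ → ℕ → Bool
isCycleMin n σ i = all (λ j → i ≤ᵇ iter σ j i) (upTo (orbitLen n σ i))

cycleType : ℕ → List ℕ → List ℕ
cycleType n σ = map (orbitLen n σ) (filterᵇ (isCycleMin n σ) (upTo n))

-- Irreducible characters χ^λ of S_n via the Murnaghan–Nakayama rule,
-- in the beta-number (abacus) formulation: for λ = (λ₁,…,λ_L) the
-- beta-set is {λ_i + L - i}; removing a rim hook of size k corresponds to
-- replacing some b by b - k ∉ β, with sign (-1)^(#{c ∈ β : b-k < c < b}).

betas : List ℕ → List ℕ
betas []       = []
betas (x ∷ xs) = (x ℕ.+ length xs) ∷ betas xs

sumℤ : List ℤ → ℤ
sumℤ = foldr ℤ._+_ (ℤ.+ 0)

signℤ : ℕ → ℤ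
signℤ zero          = ℤ.+ 1
signℤ (suc zero)    = ℤ.- (ℤ.+ 1)
signℤ (suc (suc k)) = signℤ k

memᵇ : ℕ → List ℕ → Bool
memᵇ x = any (λ c → c ≡ᵇ x)

countBetween : ℕ → ℕ → List ℕ → ℕ
countBetween a b β = length (filterᵇ (λ c → (a <ᵇ c) ∧ (c <ᵇ b)) β)

replace : ℕ → ℕ → List ℕ → List ℕ
replace b b' = map (λ c → if c ≡ᵇ b then b' else c)

χβ : List ℕ → List ℕ → ℤ
χβ β [] = if all (λ c → c <ᵇ length β) β then ℤ.+ 1 else ℤ.+ 0
χβ β (k ∷ ρ) = sumℤ (map term β)
  where
  term : ℕ → ℤ
  term b = if (k ≤ᵇ b) ∧ (Data.Bool.not (memᵇ (b ∸ k) β)) ∧ (0 <ᵇ k)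
           then signℤ (countBetween (b ∸ k) b β) ℤ.* χβ (replace b (b ∸ k) β) ρ
           else ℤ.+ 0

χ : List ℕ → List ℕ → ℤ
χ λ' ρ = χβ (betas λ') ρ

-- n! · g(λ,μ,ν) = Σ_{σ ∈ S_n} χ^λ(σ) χ^μ(σ) χ^ν(σ)

kroneckerSum : ℕ → List ℕ → List ℕ → List ℕ → ℤ
kroneckerSum n λ' μ ν =
  sumℤ (map (λ σ → let ρ = cycleType n σ in χ λ' ρ ℤ.* χ μ ρ ℤ.* χ ν ρ) (perms n))

{-# OPTIONS --safe #-}
-- Write K = ℓmr and c(σ) for the number of cycles of σ. Each Murnaghan–Nakayama step is a
-- signed sum over the ℓ(λ) beta-numbers, so |χ^λ(σ)| ≤ ℓ(λ)^c(σ) and hence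
-- n!·g(λ,μ,ν) ≤ Σ_σ K^c(σ) ≤ Σ_σ (K+1)^c(σ). Every permutation of {0,…,n} arises from one of
-- {0,…,n-1} either by adding n as a fixed point (one more cycle) or by inserting n after some i
-- in its cycle (no new cycle), so Σ_σ x^c(σ) ≤ x(x+1)⋯(x+n-1). For x = K+1 this is n!·C(n+K,n),
-- and C(n+K,n)·n^n·K^K ≤ (n+K)^(n+K) since the left side is a term of the binomial expansion.
-- This gives g ≤ (1+K/n)^n (1+n/K)^K; the two factors of the statement involving ℓm are ≥ 1.

module Submission where

open import Defs
open import Data.Bool using (Bool; true; false; T; if_then_else_; _∧_; not)
open import Data.Bool.ListAction using (all)
open import Data.Unit using (tt)
open import Data.Empty using (⊥-elim)
open import Data.Product using (∃; ∃₂; _×_; _,_; proj₁; proj₂; map₂)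
open import Function using (_∘_)
open import Relation.Nullary using (¬_; ¬?; yes; no; T?)
open import Relation.Binary.PropositionalEquality hiding ([_])

open import Data.Nat
  using (ℕ; zero; suc; _+_; _*_; _∸_; _^_; _!; _≤_; _<_; z≤n; s≤s; s≤s⁻¹; _≟_; _≡ᵇ_; _≤ᵇ_; _<ᵇ_;
         NonZero; >-nonZero)
open import Data.Nat.Properties
open import Data.Nat.DivMod using (_%_; _/_; m≡m%n+[m/n]*n; m%n<n; m/n*n≡m)
open import Data.Nat.Combinatorics
  using (_C_; nCn≡1; nCk≡nC[n∸k]; nCk+nC[k+1]≡[n+1]C[k+1]; nCk≡n!/k![n-k]!; k![n∸k]!∣n!)
open import Data.Nat.ListAction using (sum)
open import Data.Nat.ListAction.Properties using (sum-++; sum-↭)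
open import Data.Nat.Tactic.RingSolver using (solve-∀)
open import Data.Integer using (ℤ; +_; -[1+_]; ∣_∣; +≤+; -≤+)
  renaming (_*_ to _*ℤ_; _≤_ to _≤ℤ_)
import Data.Integer.Properties as ℤ
open import Data.Fin using (toℕ; fromℕ<)
open import Data.Fin.Properties using (pigeonhole; toℕ-fromℕ<; toℕ<n)

open import Data.List
  using (List; []; _∷_; [_]; _++_; _∷ʳ_; length; map; upTo; concatMap; filter; filterᵇ;
         initLast; _∷ʳ′_)
open import Data.List.Properties
  using (length-map; length-++; length-upTo; length-filter; map-++; upTo-∷ʳ; ++-identityʳ;
         filter-++; filter-reject; filter-all; ∷-injectiveˡ; ∷-injectiveʳ)
open import Data.List.Relation.Unary.All as All using (All)
open import Data.List.Relation.Unary.All.Properties using (¬Any⇒All¬; all⁺; all⁻)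
open import Data.List.Relation.Unary.Any using (Any; here; there)
open import Data.List.Relation.Unary.AllPairs using ([]; _∷_)
open import Data.List.Relation.Unary.Unique.Propositional using (Unique)
open import Data.List.Relation.Unary.Unique.Propositional.Properties using (++⁺; map⁺; upTo⁺)
open import Data.List.Membership.Propositional using (_∈_; _∉_; find; lose)
open import Data.List.Membership.Propositional.Properties
  using (∈-map⁺; ∈-map⁻; ∈-upTo⁺; ∈-upTo⁻; ∈-concatMap⁺; ∈-concatMap⁻; ∈-∃++)
open import Data.List.Relation.Binary.Permutation.Propositional
  using (_↭_; ↭-sym; ↭-trans; prep; ↭⇒↭ₛ)
open import Data.List.Relation.Binary.Permutation.Propositional.Properties as ↭
  using (shift; drop-∷; ∷↭∷ʳ; ∈-resp-↭; ↭-length; ++⁺ˡ)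
import Data.List.Relation.Binary.Permutation.Setoid.Properties as ↭ₛ

sum-map-const : ∀ {A : Set} (c : ℕ) (xs : List A) → sum (map (λ _ → c) xs) ≡ length xs * c
sum-map-const c []       = refl
sum-map-const c (x ∷ xs) = cong (_+_ c) (sum-map-const c xs)

sum-map-mono : ∀ {A : Set} {f g : A → ℕ} {xs} → (∀ {x} → x ∈ xs → f x ≤ g x) →
               sum (map f xs) ≤ sum (map g xs)
sum-map-mono {xs = []}     _   = z≤n
sum-map-mono {xs = x ∷ xs} f≤g = +-mono-≤ (f≤g (here refl)) (sum-map-mono (f≤g ∘ there))

sum-map-*ˡ : ∀ {A : Set} (c : ℕ) (f : A → ℕ) xs →
             sum (map (λ x → c * f x) xs) ≡ c * sum (map f xs)
sum-map-*ˡ c f []       = sym (*-zeroʳ c)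
sum-map-*ˡ c f (x ∷ xs) =
  trans (cong (_+_ (c * f x)) (sum-map-*ˡ c f xs)) (sym (*-distribˡ-+ c (f x) _))

sum-map-concatMap : ∀ {A B : Set} (f : B → ℕ) (g : A → List B) xs →
                    sum (map f (concatMap g xs)) ≡ sum (map (λ a → sum (map f (g a))) xs)
sum-map-concatMap f g []       = refl
sum-map-concatMap f g (a ∷ xs) = begin
  sum (map f (g a ++ concatMap g xs))
    ≡⟨ cong sum (map-++ f (g a) (concatMap g xs)) ⟩
  sum (map f (g a) ++ map f (concatMap g xs))
    ≡⟨ sum-++ (map f (g a)) _ ⟩
  sum (map f (g a)) + sum (map f (concatMap g xs))
    ≡⟨ cong (_+_ (sum (map f (g a)))) (sum-map-concatMap f g xs) ⟩
  sum (map f (g a)) + sum (map (λ a → sum (map f (g a))) xs) ∎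
  where open ≡-Reasoning

sum-map-mono-⊆ : ∀ {A : Set} (f : A → ℕ) {xs ys} → Unique xs → (∀ {x} → x ∈ xs → x ∈ ys) →
                 sum (map f xs) ≤ sum (map f ys)
sum-map-mono-⊆ f {[]}     _            _   = z≤n
sum-map-mono-⊆ f {x ∷ xs} (x∉xs ∷ xs!) xs⊆ys with ∈-∃++ (xs⊆ys (here refl))
... | as , bs , refl = begin
  f x + sum (map f xs)             ≤⟨ +-monoʳ-≤ (f x) (sum-map-mono-⊆ f xs! xs⊆as++bs) ⟩
  f x + sum (map f (as ++ bs))     ≡⟨ sum-↭ (↭.map⁺ f (shift x as bs)) ⟨
  sum (map f (as ++ x ∷ bs))       ∎
  where
  open ≤-Reasoning
  xs⊆as++bs : ∀ {z} → z ∈ xs → z ∈ as ++ bs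
  xs⊆as++bs {z} z∈xs with ∈-resp-↭ (shift x as bs) (xs⊆ys (there z∈xs))
  ... | here refl = ⊥-elim (All.lookup x∉xs z∈xs refl)
  ... | there z∈  = z∈

∣sumℤ∣≤sum : ∀ {A : Set} (f : A → ℤ) (g : A → ℕ) → (∀ x → ∣ f x ∣ ≤ g x) →
             ∀ xs → ∣ sumℤ (map f xs) ∣ ≤ sum (map g xs)
∣sumℤ∣≤sum f g f≤g []       = z≤n
∣sumℤ∣≤sum f g f≤g (x ∷ xs) =
  ≤-trans (ℤ.∣i+j∣≤∣i∣+∣j∣ (f x) _) (+-mono-≤ (f≤g x) (∣sumℤ∣≤sum f g f≤g xs))

i≤+∣i∣ : ∀ i → i ≤ℤ + ∣ i ∣
i≤+∣i∣ (+ n)    = ℤ.≤-refl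
i≤+∣i∣ -[1+ n ] = -≤+

^-distribʳ-* : ∀ a b k → (a * b) ^ k ≡ a ^ k * b ^ k
^-distribʳ-* a b zero    = refl
^-distribʳ-* a b (suc k) =
  trans (cong (a * b *_) (^-distribʳ-* a b k)) (interchange a b (a ^ k) (b ^ k))
  where
  interchange : ∀ a b c d → a * b * (c * d) ≡ a * c * (b * d)
  interchange = solve-∀

-- Character values

cycleCount : ℕ → List ℕ → ℕ
cycleCount n σ = length (cycleType n σ)

cycleSum : ℕ → List (List ℕ) → ℕ → ℕ
cycleSum n σs x = sum (map (λ σ → x ^ cycleCount n σ) σs)

∣signℤ*i∣≡∣i∣ : ∀ k i → ∣ signℤ k *ℤ i ∣ ≡ ∣ i ∣
∣signℤ*i∣≡∣i∣ k i =
  trans (ℤ.abs-* (signℤ k) i) (trans (cong (_* ∣ i ∣) (∣signℤ∣ k)) (*-identityˡ ∣ i ∣))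
  where
  ∣signℤ∣ : ∀ k → ∣ signℤ k ∣ ≡ 1
  ∣signℤ∣ zero          = refl
  ∣signℤ∣ (suc zero)    = refl
  ∣signℤ∣ (suc (suc k)) = ∣signℤ∣ k

∣if-then-0∣≤ : ∀ c {i B} → ∣ i ∣ ≤ B → ∣ (if c then i else + 0) ∣ ≤ B
∣if-then-0∣≤ true  ∣i∣≤B = ∣i∣≤B
∣if-then-0∣≤ false _     = z≤n

∣χβ∣≤ : ∀ β ρ → ∣ χβ β ρ ∣ ≤ length β ^ length ρ
∣χβ∣≤ β []      = ∣if-then-0∣≤ (all (λ c → c <ᵇ length β) β) ≤-refl
∣χβ∣≤ β (k ∷ ρ) = subst (∣ χβ β (k ∷ ρ) ∣ ≤_) (sum-map-const _ β)
  (∣sumℤ∣≤sum _ _ (λ b → ∣if-then-0∣≤ (removable b) (∣removal∣≤ b)) β)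
  where
  removable : ℕ → Bool
  removable b = (k ≤ᵇ b) ∧ not (memᵇ (b ∸ k) β) ∧ (0 <ᵇ k)

  ∣removal∣≤ : ∀ b → ∣ signℤ (countBetween (b ∸ k) b β) *ℤ χβ (replace b (b ∸ k) β) ρ ∣
                     ≤ length β ^ length ρ
  ∣removal∣≤ b = begin
    ∣ signℤ s *ℤ χβ β′ ρ ∣  ≡⟨ ∣signℤ*i∣≡∣i∣ s (χβ β′ ρ) ⟩
    ∣ χβ β′ ρ ∣             ≤⟨ ∣χβ∣≤ β′ ρ ⟩
    length β′ ^ length ρ    ≡⟨ cong (_^ length ρ) (length-map _ β) ⟩
    length β ^ length ρ     ∎
    where
    open ≤-Reasoning
    s  = countBetween (b ∸ k) b β
    β′ = replace b (b ∸ k) β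

length-betas : ∀ λ′ → length (betas λ′) ≡ len λ′
length-betas []       = refl
length-betas (x ∷ λ′) = cong suc (length-betas λ′)

∣χ∣≤ : ∀ λ′ ρ → ∣ χ λ′ ρ ∣ ≤ len λ′ ^ length ρ
∣χ∣≤ λ′ ρ =
  subst (λ l → ∣ χ λ′ ρ ∣ ≤ l ^ length ρ) (length-betas λ′) (∣χβ∣≤ (betas λ′) ρ)

kroneckerSum≤cycleSum : ∀ n λ′ μ ν →
  kroneckerSum n λ′ μ ν ≤ℤ + cycleSum n (perms n) (len λ′ * len μ * len ν)
kroneckerSum≤cycleSum n λ′ μ ν =
  ℤ.≤-trans (i≤+∣i∣ _) (+≤+ (∣sumℤ∣≤sum _ _ ∣χχχ∣≤ (perms n)))
  where
  ∣χχχ∣≤ : ∀ σ → let ρ = cycleType n σ in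
           ∣ χ λ′ ρ *ℤ χ μ ρ *ℤ χ ν ρ ∣ ≤ (len λ′ * len μ * len ν) ^ cycleCount n σ
  ∣χχχ∣≤ σ = begin
    ∣ χ λ′ ρ *ℤ χ μ ρ *ℤ χ ν ρ ∣       ≡⟨ ℤ.abs-* (χ λ′ ρ *ℤ χ μ ρ) (χ ν ρ) ⟩
    ∣ χ λ′ ρ *ℤ χ μ ρ ∣ * ∣ χ ν ρ ∣     ≡⟨ cong (_* ∣ χ ν ρ ∣) (ℤ.abs-* (χ λ′ ρ) (χ μ ρ)) ⟩
    ∣ χ λ′ ρ ∣ * ∣ χ μ ρ ∣ * ∣ χ ν ρ ∣  ≤⟨ *-mono-≤ (*-mono-≤ (∣χ∣≤ λ′ ρ) (∣χ∣≤ μ ρ)) (∣χ∣≤ ν ρ) ⟩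
    len λ′ ^ c * len μ ^ c * len ν ^ c  ≡⟨ cong (_* len ν ^ c) (^-distribʳ-* (len λ′) (len μ) c) ⟨
    (len λ′ * len μ) ^ c * len ν ^ c    ≡⟨ ^-distribʳ-* (len λ′ * len μ) (len ν) c ⟨
    (len λ′ * len μ * len ν) ^ c        ∎
    where
    open ≤-Reasoning
    ρ = cycleType n σ
    c = length ρ

-- Two enumerations of the symmetric group

IsPerm : ℕ → List ℕ → Set
IsPerm n σ = σ ↭ upTo n

IsPerm⇒length≡ : ∀ {n σ} → IsPerm n σ → length σ ≡ n
IsPerm⇒length≡ {n} p = trans (↭-length p) (length-upTo n)

IsPerm⇒∉ : ∀ {n σ} → IsPerm n σ → n ∉ σ
IsPerm⇒∉ p n∈σ = <-irrefl refl (∈-upTo⁻ (∈-resp-↭ p n∈σ))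

∷upTo↭upTo-suc : ∀ n → n ∷ upTo n ↭ upTo (suc n)
∷upTo↭upTo-suc n = subst (n ∷ upTo n ↭_) (upTo-∷ʳ n) (∷↭∷ʳ n (upTo n))

IsPerm-insert⁺ : ∀ {n} as bs → IsPerm n (as ++ bs) → IsPerm (suc n) (as ++ n ∷ bs)
IsPerm-insert⁺ {n} as bs p = ↭-trans (shift n as bs) (↭-trans (prep n p) (∷upTo↭upTo-suc n))

IsPerm-insert⁻ : ∀ {n} as bs → IsPerm (suc n) (as ++ n ∷ bs) → IsPerm n (as ++ bs)
IsPerm-insert⁻ {n} as bs p =
  drop-∷ (↭-trans (↭-sym (shift n as bs)) (↭-trans p (↭-sym (∷upTo↭upTo-suc n))))

∈-insertions⁻ : ∀ {x ρ τ} → τ ∈ insertions x ρ →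
                ∃₂ λ as bs → ρ ≡ as ++ bs × τ ≡ as ++ x ∷ bs
∈-insertions⁻ {ρ = []}     (here refl) = [] , [] , refl , refl
∈-insertions⁻ {ρ = y ∷ ys} (here refl) = [] , y ∷ ys , refl , refl
∈-insertions⁻ {ρ = y ∷ ys} (there τ∈) with ∈-map⁻ (y ∷_) τ∈
... | τ′ , τ′∈ , refl with ∈-insertions⁻ τ′∈
...   | as , bs , refl , refl = y ∷ as , bs , refl , refl

insertions-unique : ∀ {x} ρ → x ∉ ρ → Unique (insertions x ρ)
insertions-unique []       _   = All.[] ∷ []
insertions-unique {x} (y ∷ ys) x∉ =
  All.tabulate head≢ ∷ map⁺ ∷-injectiveʳ (insertions-unique ys (x∉ ∘ there))
  where
  head≢ : ∀ {τ} → τ ∈ map (y ∷_) (insertions x ys) → x ∷ y ∷ ys ≢ τ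
  head≢ τ∈ eq with ∈-map⁻ (y ∷_) τ∈
  ... | _ , _ , refl = x∉ (here (∷-injectiveˡ eq))

perms-sound : ∀ {n σ} → σ ∈ perms n → IsPerm n σ
perms-sound {zero}  (here refl) = _↭_.refl
perms-sound {suc n} σ∈ with find (∈-concatMap⁻ (insertions n) {xs = perms n} σ∈)
... | ρ , ρ∈ , σ∈ins with ∈-insertions⁻ σ∈ins
...   | as , bs , refl , refl = IsPerm-insert⁺ as bs (perms-sound ρ∈)

concatMap-unique : ∀ {A B : Set} {f : A → List B} (g : B → A) {xs} → Unique xs →
  (∀ {a} → a ∈ xs → Unique (f a)) → (∀ {a b} → a ∈ xs → b ∈ f a → g b ≡ a) →
  Unique (concatMap f xs)
concatMap-unique g {[]}     _            _        _      = []
concatMap-unique {f = f} g {a ∷ xs} (a∉xs ∷ xs!) f-unique g-inv =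
  ++⁺ (f-unique (here refl)) (concatMap-unique g xs! (f-unique ∘ there) (g-inv ∘ there)) disjoint
  where
  disjoint : ∀ {b} → ¬ (b ∈ f a × b ∈ concatMap f xs)
  disjoint (b∈fa , b∈rest) with find (∈-concatMap⁻ f {xs = xs} b∈rest)
  ... | a′ , a′∈ , b∈fa′ =
    All.lookup a∉xs a′∈ (trans (sym (g-inv (here refl) b∈fa)) (g-inv (there a′∈) b∈fa′))

remove : ℕ → List ℕ → List ℕ
remove x = filter (λ c → ¬? (c ≟ x))

remove-insert : ∀ {x} as bs → x ∉ as ++ bs → remove x (as ++ x ∷ bs) ≡ as ++ bs
remove-insert {x} as bs x∉ = begin
  remove x (as ++ x ∷ bs)           ≡⟨ filter-++ P? as (x ∷ bs) ⟩
  remove x as ++ remove x (x ∷ bs)  ≡⟨ cong (remove x as ++_) (filter-reject P? (λ x≢x → x≢x refl)) ⟩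
  remove x as ++ remove x bs        ≡⟨ filter-++ P? as bs ⟨
  remove x (as ++ bs)               ≡⟨ filter-all P? (All.map (λ x≢c → x≢c ∘ sym) (¬Any⇒All¬ _ x∉)) ⟩
  as ++ bs                          ∎
  where
  open ≡-Reasoning
  P? = λ c → ¬? (c ≟ x)

perms-unique : ∀ n → Unique (perms n)
perms-unique zero    = All.[] ∷ []
perms-unique (suc n) = concatMap-unique (remove n) (perms-unique n)
  (λ ρ∈ → insertions-unique _ (IsPerm⇒∉ (perms-sound ρ∈)))
  remove-insertion
  where
  remove-insertion : ∀ {ρ τ} → ρ ∈ perms n → τ ∈ insertions n ρ → remove n τ ≡ ρ
  remove-insertion ρ∈ τ∈ with ∈-insertions⁻ τ∈
  ... | as , bs , refl , refl = remove-insert as bs (IsPerm⇒∉ (perms-sound ρ∈))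

-- perms (from Defs) inserts n into the one-line notation, which does not track cycles, so
-- sums over it are bounded through cyclePerms ⊇ perms, where n is inserted into a cycle:
-- cycleInsert n σ i is τ with τ i = n, τ n = σ i (the [] clause, i out of range, is junk).
cycleInsert : ℕ → List ℕ → ℕ → List ℕ
cycleInsert n []       i       = [ n ]
cycleInsert n (y ∷ ys) zero    = n ∷ ys ∷ʳ y
cycleInsert n (y ∷ ys) (suc i) = y ∷ cycleInsert n ys i

cycleInsertions : ℕ → List ℕ → List (List ℕ)
cycleInsertions n σ = (σ ∷ʳ n) ∷ map (cycleInsert n σ) (upTo n)

cyclePerms : ℕ → List (List ℕ)
cyclePerms zero    = [ [] ]
cyclePerms (suc n) = concatMap (cycleInsertions n) (cyclePerms n)

cycleInsert-++ : ∀ n as y bs → cycleInsert n (as ++ y ∷ bs) (length as) ≡ as ++ n ∷ bs ∷ʳ y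
cycleInsert-++ n []       y bs = refl
cycleInsert-++ n (a ∷ as) y bs = cong (a ∷_) (cycleInsert-++ n as y bs)

splitAt-< : ∀ (σ : List ℕ) {i} → i < length σ →
            ∃₂ λ as y → ∃ λ bs → σ ≡ as ++ y ∷ bs × length as ≡ i
splitAt-< (y ∷ σ) {zero}  _         = [] , y , σ , refl , refl
splitAt-< (x ∷ σ) {suc i} (s≤s i<) with splitAt-< σ i<
... | as , y , bs , refl , refl = x ∷ as , y , bs , refl , refl

IsPerm-cycleInsert⁺ : ∀ {n} as y bs →
                      IsPerm n (as ++ y ∷ bs) → IsPerm (suc n) (as ++ n ∷ bs ∷ʳ y)
IsPerm-cycleInsert⁺ as y bs p =
  IsPerm-insert⁺ as (bs ∷ʳ y) (↭-trans (++⁺ˡ as (↭-sym (∷↭∷ʳ y bs))) p)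

IsPerm-cycleInsert⁻ : ∀ {n} as y bs →
                      IsPerm (suc n) (as ++ n ∷ bs ∷ʳ y) → IsPerm n (as ++ y ∷ bs)
IsPerm-cycleInsert⁻ as y bs p = ↭-trans (++⁺ˡ as (∷↭∷ʳ y bs)) (IsPerm-insert⁻ as (bs ∷ʳ y) p)

IsPerm-cycleInsertions : ∀ {n σ τ} → IsPerm n σ → τ ∈ cycleInsertions n σ → IsPerm (suc n) τ
IsPerm-cycleInsertions {n} {σ} p (here refl) =
  IsPerm-insert⁺ σ [] (subst (IsPerm n) (sym (++-identityʳ σ)) p)
IsPerm-cycleInsertions {n} {σ} p (there τ∈) with ∈-map⁻ (cycleInsert n σ) τ∈
... | i , i∈ , refl with splitAt-< σ (subst (i <_) (sym (IsPerm⇒length≡ p)) (∈-upTo⁻ i∈))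
...   | as , y , bs , refl , refl rewrite cycleInsert-++ n as y bs = IsPerm-cycleInsert⁺ as y bs p

cyclePerms-sound : ∀ {n σ} → σ ∈ cyclePerms n → IsPerm n σ
cyclePerms-sound {zero}  (here refl) = _↭_.refl
cyclePerms-sound {suc n} σ∈ with find (∈-concatMap⁻ (cycleInsertions n) {xs = cyclePerms n} σ∈)
... | ρ , ρ∈ , σ∈ins = IsPerm-cycleInsertions (cyclePerms-sound ρ∈) σ∈ins

cyclePerms-complete : ∀ {n τ} → IsPerm n τ → τ ∈ cyclePerms n
cyclePerms-complete {zero} {[]}    _ = here refl
cyclePerms-complete {zero} {_ ∷ _} p with () ← ↭-length p
cyclePerms-complete {suc n} p with ∈-∃++ (∈-resp-↭ (↭-sym p) (∈-upTo⁺ (n<1+n n)))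
... | as , bs , refl with initLast bs
...   | [] = ∈-concatMap⁺ (cycleInsertions n) (lose σ∈ (here refl))
  where
  σ∈ : as ∈ cyclePerms n
  σ∈ = cyclePerms-complete (subst (IsPerm n) (++-identityʳ as) (IsPerm-insert⁻ as [] p))
...   | bs′ ∷ʳ′ y = subst (_∈ cyclePerms (suc n)) (cycleInsert-++ n as y bs′)
  (∈-concatMap⁺ (cycleInsertions n) (lose σ∈ (there (∈-map⁺ (cycleInsert n σ) (∈-upTo⁺ i<n)))))
  where
  σ = as ++ y ∷ bs′
  σ-perm : IsPerm n σ
  σ-perm = IsPerm-cycleInsert⁻ as y bs′ p
  σ∈ : σ ∈ cyclePerms n
  σ∈ = cyclePerms-complete σ-perm
  i<n : length as < n
  i<n = subst (length as <_) (trans (sym (length-++ as)) (IsPerm⇒length≡ σ-perm))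
              (m<m+n (length as) (s≤s z≤n))

-- Orbits

firstᵇ-satisfies : ∀ {p : ℕ → Bool} {xs} → Any (T ∘ p) xs →
                   T (p (firstᵇ p xs)) × firstᵇ p xs ∈ xs
firstᵇ-satisfies {p} {x ∷ xs} p-somewhere with p x in px≡
... | true = subst T (sym px≡) tt , here refl
... | false with p-somewhere
...   | here px         = ⊥-elim (subst T px≡ px)
...   | there p-in-tail = map₂ there (firstᵇ-satisfies p-in-tail)

app-∈ : ∀ σ {x} → x < length σ → app σ x ∈ σ
app-∈ (a ∷ σ) {zero}  _        = here refl
app-∈ (a ∷ σ) {suc x} (s≤s x<) = there (app-∈ σ x<)

app-injective : ∀ {σ x y} → Unique σ → x < length σ → y < length σ → app σ x ≡ app σ y → x ≡ y
app-injective {a ∷ σ} {zero}  {zero}  _        _        _        _  = refl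
app-injective {a ∷ σ} {zero}  {suc y} (a∉ ∷ _) _        (s≤s y<) eq =
  ⊥-elim (All.lookup a∉ (app-∈ σ y<) eq)
app-injective {a ∷ σ} {suc x} {zero}  (a∉ ∷ _) (s≤s x<) _        eq =
  ⊥-elim (All.lookup a∉ (app-∈ σ x<) (sym eq))
app-injective {a ∷ σ} {suc x} {suc y} (_ ∷ σ!) (s≤s x<) (s≤s y<) eq =
  cong suc (app-injective σ! x< y< eq)

iter-+ : ∀ σ a b x → iter σ (a + b) x ≡ iter σ a (iter σ b x)
iter-+ σ zero    b x = refl
iter-+ σ (suc a) b x = cong (app σ) (iter-+ σ a b x)

iter-*-period : ∀ σ {L x} → iter σ L x ≡ x → ∀ k → iter σ (k * L) x ≡ x
iter-*-period σ         period zero    = refl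
iter-*-period σ {L} {x} period (suc k) =
  trans (iter-+ σ L (k * L) x) (trans (cong (iter σ L) (iter-*-period σ period k)) period)

iter-% : ∀ σ {L x} .{{_ : NonZero L}} → iter σ L x ≡ x →
         ∀ j → iter σ j x ≡ iter σ (j % L) x
iter-% σ {L} {x} period j = begin
  iter σ j x                               ≡⟨ cong (λ i → iter σ i x) (m≡m%n+[m/n]*n j L) ⟩
  iter σ (j % L + (j / L) * L) x           ≡⟨ iter-+ σ (j % L) ((j / L) * L) x ⟩
  iter σ (j % L) (iter σ ((j / L) * L) x)  ≡⟨ cong (iter σ (j % L)) (iter-*-period σ period (j / L)) ⟩
  iter σ (j % L) x                         ∎
  where open ≡-Reasoning

IsOrbitMin : List ℕ → ℕ → Set
IsOrbitMin σ x = ∀ j → x ≤ iter σ j x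

IsOrbitMin⇒isCycleMin : ∀ m σ {x} → IsOrbitMin σ x → T (isCycleMin m σ x)
IsOrbitMin⇒isCycleMin m σ {x} min =
  all⁻ _ {upTo (orbitLen m σ x)} (All.tabulate λ {j} _ → ≤⇒≤ᵇ (min j))

module _ {n σ} (σ-perm : IsPerm n σ) where

  private
    x<n⇒x<length : ∀ {x} → x < n → x < length σ
    x<n⇒x<length = subst (_ <_) (sym (IsPerm⇒length≡ σ-perm))

  app-< : ∀ {x} → x < n → app σ x < n
  app-< x<n = ∈-upTo⁻ (∈-resp-↭ σ-perm (app-∈ σ (x<n⇒x<length x<n)))

  app-injective-perm : ∀ {x y} → x < n → y < n → app σ x ≡ app σ y → x ≡ y
  app-injective-perm x<n y<n = app-injective σ-unique (x<n⇒x<length x<n) (x<n⇒x<length y<n)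
    where σ-unique = ↭ₛ.Unique-resp-↭ (setoid ℕ) (↭⇒↭ₛ (↭-sym σ-perm)) (upTo⁺ n)

  iter-< : ∀ j {x} → x < n → iter σ j x < n
  iter-< zero    x<n = x<n
  iter-< (suc j) x<n = app-< (iter-< j x<n)

  iter-injective : ∀ j {x y} → x < n → y < n → iter σ j x ≡ iter σ j y → x ≡ y
  iter-injective zero    _   _   eq = eq
  iter-injective (suc j) x<n y<n eq =
    iter-injective j x<n y<n (app-injective-perm (iter-< j x<n) (iter-< j y<n) eq)

  iter-period : ∀ {x} → x < n → ∃ λ q → q < n × iter σ (suc q) x ≡ x
  iter-period {x} x<n with pigeonhole (n<1+n n) (λ k → fromℕ< (iter-< (toℕ k) x<n))
  ... | i , j , i<j , same with m≤n⇒∃[o]m+o≡n i<j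
  ...   | q , i+1+q≡j = q , q<n , sym (iter-injective (toℕ i) x<n (iter-< (suc q) x<n) iterᵢ≡)
    where
    j≡i+1+q : toℕ j ≡ toℕ i + suc q
    j≡i+1+q = trans (sym i+1+q≡j) (sym (+-suc (toℕ i) q))
    q<n : q < n
    q<n = begin-strict
      q              <⟨ m≤n+m (suc q) (toℕ i) ⟩
      toℕ i + suc q  ≡⟨ j≡i+1+q ⟨
      toℕ j          ≤⟨ s≤s⁻¹ (toℕ<n j) ⟩
      n              ∎
      where open ≤-Reasoning
    iterᵢ≡ : iter σ (toℕ i) x ≡ iter σ (toℕ i) (iter σ (suc q) x)
    iterᵢ≡ = begin
      iter σ (toℕ i) x                      ≡⟨ toℕ-fromℕ< (iter-< (toℕ i) x<n) ⟨
      toℕ (fromℕ< (iter-< (toℕ i) x<n))     ≡⟨ cong toℕ same ⟩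
      toℕ (fromℕ< (iter-< (toℕ j) x<n))     ≡⟨ toℕ-fromℕ< (iter-< (toℕ j) x<n) ⟩
      iter σ (toℕ j) x                      ≡⟨ cong (λ k → iter σ k x) j≡i+1+q ⟩
      iter σ (toℕ i + suc q) x              ≡⟨ iter-+ σ (toℕ i) (suc q) x ⟩
      iter σ (toℕ i) (iter σ (suc q) x)     ∎
      where open ≡-Reasoning

  orbitLen-period : ∀ {x} → x < n → 0 < orbitLen n σ x × iter σ (orbitLen n σ x) x ≡ x
  orbitLen-period {x} x<n with iter-period x<n
  ... | q , q<n , period with firstᵇ-satisfies {p = λ k → iter σ k x ≡ᵇ x} {xs = map suc (upTo n)}
                                 (lose (∈-map⁺ suc (∈-upTo⁺ q<n)) (≡⇒≡ᵇ _ _ period))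
  ...   | returns , ∈xs with ∈-map⁻ suc ∈xs
  ...     | _ , _ , len≡ = subst (0 <_) (sym len≡) (s≤s z≤n) , ≡ᵇ⇒≡ _ _ returns

  -- isCycleMin only inspects the first orbitLen iterates; these are all of them because
  -- orbitLen is a period, which is where the pigeonhole argument enters.
  isCycleMin⇒IsOrbitMin : ∀ {x} → x < n → T (isCycleMin n σ x) → IsOrbitMin σ x
  isCycleMin⇒IsOrbitMin {x} x<n cycleMin j = subst (x ≤_) (sym (iter-% σ period j))
    (≤ᵇ⇒≤ x _ (All.lookup (all⁺ _ _ cycleMin) (∈-upTo⁺ (m%n<n j (orbitLen n σ x)))))
    where
    period = proj₂ (orbitLen-period x<n)
    instance _ = >-nonZero (proj₁ (orbitLen-period x<n))

-- Counting cycles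

filterᵇ-length-mono : ∀ {p q : ℕ → Bool} xs → (∀ {k} → k ∈ xs → T (p k) → T (q k)) →
                      length (filterᵇ p xs) ≤ length (filterᵇ q xs)
filterᵇ-length-mono             []       _   = z≤n
filterᵇ-length-mono {p} {q} (x ∷ xs) p⇒q with p x in px | q x in qx
... | true  | true  = s≤s (filterᵇ-length-mono xs (p⇒q ∘ there))
... | false | true  = m≤n⇒m≤1+n (filterᵇ-length-mono xs (p⇒q ∘ there))
... | false | false = filterᵇ-length-mono xs (p⇒q ∘ there)
... | true  | false = ⊥-elim (subst T qx (p⇒q (here refl) (subst T (sym px) _)))

OrbitIncluded : List ℕ → List ℕ → ℕ → Set
OrbitIncluded σ τ k = ∀ j → ∃ λ j′ → iter σ j k ≡ iter τ j′ k

cycleCount-suc≤ : ∀ {n σ τ} → IsPerm (suc n) τ → (∀ {k} → k < n → OrbitIncluded σ τ k) →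
                  cycleCount (suc n) τ ≤ cycleCount n σ + length (filterᵇ (isCycleMin (suc n) τ) [ n ])
cycleCount-suc≤ {n} {σ} {τ} τ-perm included = begin
  cycleCount (suc n) τ
    ≡⟨ length-map (orbitLen (suc n) τ) (filterᵇ τ-min (upTo (suc n))) ⟩
  length (filterᵇ τ-min (upTo (suc n)))
    ≡⟨ cong (length ∘ filterᵇ τ-min) (upTo-∷ʳ n) ⟨
  length (filterᵇ τ-min (upTo n ++ [ n ]))
    ≡⟨ cong length (filter-++ _ (upTo n) [ n ]) ⟩
  length (filterᵇ τ-min (upTo n) ++ filterᵇ τ-min [ n ])
    ≡⟨ length-++ (filterᵇ τ-min (upTo n)) ⟩
  length (filterᵇ τ-min (upTo n)) + length (filterᵇ τ-min [ n ])
    ≤⟨ +-monoˡ-≤ _ (filterᵇ-length-mono (upTo n) (min⇒min ∘ ∈-upTo⁻)) ⟩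
  length (filterᵇ σ-min (upTo n)) + length (filterᵇ τ-min [ n ])
    ≡⟨ cong (_+ _) (length-map (orbitLen n σ) (filterᵇ σ-min (upTo n))) ⟨
  cycleCount n σ + length (filterᵇ τ-min [ n ]) ∎
  where
  open ≤-Reasoning
  σ-min = isCycleMin n σ
  τ-min = isCycleMin (suc n) τ
  min⇒min : ∀ {k} → k < n → T (τ-min k) → T (σ-min k)
  min⇒min {k} k<n τ-min-k = IsOrbitMin⇒isCycleMin n σ λ j →
    let j′ , σʲk≡τʲ′k = included k<n j
    in subst (k ≤_) (sym σʲk≡τʲ′k) (isCycleMin⇒IsOrbitMin τ-perm (m<n⇒m<1+n k<n) τ-min-k j′)

app-++ˡ : ∀ xs ys {x} → x < length xs → app (xs ++ ys) x ≡ app xs x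
app-++ˡ (a ∷ xs) ys {zero}  _        = refl
app-++ˡ (a ∷ xs) ys {suc x} (s≤s x<) = app-++ˡ xs ys x<

app-∷ʳ-length : ∀ xs w → app (xs ∷ʳ w) (length xs) ≡ w
app-∷ʳ-length []       w = refl
app-∷ʳ-length (a ∷ xs) w = app-∷ʳ-length xs w

app-cycleInsert-at : ∀ n σ {i} → i < length σ → app (cycleInsert n σ i) i ≡ n
app-cycleInsert-at n (y ∷ ys) {zero}  _        = refl
app-cycleInsert-at n (y ∷ ys) {suc i} (s≤s i<) = app-cycleInsert-at n ys i<

app-cycleInsert-length : ∀ n σ {i} → i < length σ → app (cycleInsert n σ i) (length σ) ≡ app σ i
app-cycleInsert-length n (y ∷ ys) {zero}  _        = app-∷ʳ-length ys y
app-cycleInsert-length n (y ∷ ys) {suc i} (s≤s i<) = app-cycleInsert-length n ys i<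

app-cycleInsert-≢ : ∀ n σ {i x} → x < length σ → x ≢ i → app (cycleInsert n σ i) x ≡ app σ x
app-cycleInsert-≢ n (y ∷ ys) {zero}  {zero}  _        0≢0 = ⊥-elim (0≢0 refl)
app-cycleInsert-≢ n (y ∷ ys) {zero}  {suc x} (s≤s x<) _   = app-++ˡ ys [ y ] x<
app-cycleInsert-≢ n (y ∷ ys) {suc i} {zero}  _        _   = refl
app-cycleInsert-≢ n (y ∷ ys) {suc i} {suc x} (s≤s x<) x≢i =
  app-cycleInsert-≢ n ys x< (x≢i ∘ cong suc)

cycleCount-∷ʳ≤ : ∀ {n σ} → IsPerm n σ → cycleCount (suc n) (σ ∷ʳ n) ≤ suc (cycleCount n σ)
cycleCount-∷ʳ≤ {n} {σ} σ-perm = begin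
  cycleCount (suc n) τ
    ≤⟨ cycleCount-suc≤ τ-perm (λ k<n j → j , sym (iter-∷ʳ j k<n)) ⟩
  cycleCount n σ + length (filterᵇ (isCycleMin (suc n) τ) [ n ])
    ≤⟨ +-monoʳ-≤ (cycleCount n σ) (length-filter (T? ∘ isCycleMin (suc n) τ) [ n ]) ⟩
  cycleCount n σ + 1
    ≡⟨ +-comm _ 1 ⟩
  suc (cycleCount n σ) ∎
  where
  open ≤-Reasoning
  τ = σ ∷ʳ n
  τ-perm : IsPerm (suc n) τ
  τ-perm = IsPerm-cycleInsertions σ-perm (here refl)
  iter-∷ʳ : ∀ j {k} → k < n → iter τ j k ≡ iter σ j k
  iter-∷ʳ zero    k<n = refl
  iter-∷ʳ (suc j) k<n rewrite iter-∷ʳ j k<n =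
    app-++ˡ σ [ n ] (subst (_ <_) (sym (IsPerm⇒length≡ σ-perm)) (iter-< σ-perm j k<n))

cycleCount-cycleInsert≤ : ∀ {n σ i} → IsPerm n σ → i < n →
                          cycleCount (suc n) (cycleInsert n σ i) ≤ cycleCount n σ
cycleCount-cycleInsert≤ {n} {σ} {i} σ-perm i<n = begin
  cycleCount (suc n) τ
    ≤⟨ cycleCount-suc≤ τ-perm orbit-included ⟩
  cycleCount n σ + length (filterᵇ (isCycleMin (suc n) τ) [ n ])
    ≡⟨ cong (λ xs → cycleCount n σ + length xs) (filter-reject (T? ∘ isCycleMin (suc n) τ) n-not-min) ⟩
  cycleCount n σ + 0
    ≡⟨ +-identityʳ _ ⟩
  cycleCount n σ ∎
  where
  open ≤-Reasoning
  τ = cycleInsert n σ i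
  τ-perm : IsPerm (suc n) τ
  τ-perm = IsPerm-cycleInsertions σ-perm (there (∈-map⁺ (cycleInsert n σ) (∈-upTo⁺ i<n)))
  <length : ∀ {x} → x < n → x < length σ
  <length = subst (_ <_) (sym (IsPerm⇒length≡ σ-perm))
  τn≡σi : app τ n ≡ app σ i
  τn≡σi = trans (cong (app τ) (sym (IsPerm⇒length≡ σ-perm)))
                (app-cycleInsert-length n σ (<length i<n))
  orbit-included : ∀ {k} → k < n → OrbitIncluded σ τ k
  orbit-included k<n zero = zero , refl
  orbit-included {k} k<n (suc j) with orbit-included k<n j | iter σ j k ≟ i
  ... | j′ , σʲk≡τʲ′k | no σʲk≢i = suc j′ , (begin-equality
    app σ (iter σ j k)     ≡⟨ app-cycleInsert-≢ n σ (<length (iter-< σ-perm j k<n)) σʲk≢i ⟨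
    app τ (iter σ j k)     ≡⟨ cong (app τ) σʲk≡τʲ′k ⟩
    app τ (iter τ j′ k)    ∎)
  ... | j′ , σʲk≡τʲ′k | yes refl = suc (suc j′) , (begin-equality
    app σ i                ≡⟨ τn≡σi ⟨
    app τ n                ≡⟨ cong (app τ) (app-cycleInsert-at n σ (<length i<n)) ⟨
    app τ (app τ i)        ≡⟨ cong (app τ ∘ app τ) σʲk≡τʲ′k ⟩
    app τ (app τ (iter τ j′ k)) ∎)
  n-not-min : ¬ T (isCycleMin (suc n) τ n)
  n-not-min n-min = <⇒≱ (subst (_< n) (sym τn≡σi) (app-< σ-perm i<n))
                        (isCycleMin⇒IsOrbitMin τ-perm (n<1+n n) n-min 1)

-- Generating function of cycle counts

risingFactorial : ℕ → ℕ → ℕ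
risingFactorial x zero    = 1
risingFactorial x (suc n) = risingFactorial x n * (x + n)

cycleSum-cycleInsertions≤ : ∀ x .{{_ : NonZero x}} {n σ} → IsPerm n σ →
  cycleSum (suc n) (cycleInsertions n σ) x ≤ (x + n) * x ^ cycleCount n σ
cycleSum-cycleInsertions≤ x {n} {σ} σ-perm = begin
  x ^ cycleCount (suc n) (σ ∷ʳ n) + cycleSum (suc n) (map (cycleInsert n σ) (upTo n)) x
    ≤⟨ +-mono-≤ (^-monoʳ-≤ x (cycleCount-∷ʳ≤ σ-perm)) (sum-map-mono insert≤) ⟩
  x * x ^ c + sum (map (λ _ → x ^ c) (map (cycleInsert n σ) (upTo n)))
    ≡⟨ cong (_+_ (x * x ^ c)) (sum-map-const (x ^ c) (map (cycleInsert n σ) (upTo n))) ⟩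
  x * x ^ c + length (map (cycleInsert n σ) (upTo n)) * x ^ c
    ≡⟨ cong (λ l → x * x ^ c + l * x ^ c) (trans (length-map _ (upTo n)) (length-upTo n)) ⟩
  x * x ^ c + n * x ^ c
    ≡⟨ *-distribʳ-+ (x ^ c) x n ⟨
  (x + n) * x ^ c ∎
  where
  open ≤-Reasoning
  c = cycleCount n σ
  insert≤ : ∀ {τ} → τ ∈ map (cycleInsert n σ) (upTo n) → x ^ cycleCount (suc n) τ ≤ x ^ c
  insert≤ τ∈ with ∈-map⁻ (cycleInsert n σ) τ∈
  ... | i , i∈ , refl = ^-monoʳ-≤ x (cycleCount-cycleInsert≤ σ-perm (∈-upTo⁻ i∈))

cycleSum-cyclePerms≤ : ∀ x .{{_ : NonZero x}} n →
                       cycleSum n (cyclePerms n) x ≤ risingFactorial x n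
cycleSum-cyclePerms≤ x zero    = ≤-refl
cycleSum-cyclePerms≤ x (suc n) = begin
  cycleSum (suc n) (cyclePerms (suc n)) x
    ≡⟨ sum-map-concatMap (λ τ → x ^ cycleCount (suc n) τ) (cycleInsertions n) (cyclePerms n) ⟩
  sum (map (λ σ → cycleSum (suc n) (cycleInsertions n σ) x) (cyclePerms n))
    ≤⟨ sum-map-mono {xs = cyclePerms n} (cycleSum-cycleInsertions≤ x ∘ cyclePerms-sound) ⟩
  sum (map (λ σ → (x + n) * x ^ cycleCount n σ) (cyclePerms n))
    ≡⟨ sum-map-*ˡ (x + n) (λ σ → x ^ cycleCount n σ) (cyclePerms n) ⟩
  (x + n) * cycleSum n (cyclePerms n) x
    ≤⟨ *-monoʳ-≤ (x + n) (cycleSum-cyclePerms≤ x n) ⟩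
  (x + n) * risingFactorial x n
    ≡⟨ *-comm (x + n) _ ⟩
  risingFactorial x (suc n) ∎
  where open ≤-Reasoning

cycleSum-perms≤ : ∀ x .{{_ : NonZero x}} n → cycleSum n (perms n) x ≤ risingFactorial x n
cycleSum-perms≤ x n = ≤-trans
  (sum-map-mono-⊆ (λ σ → x ^ cycleCount n σ) {ys = cyclePerms n} (perms-unique n)
                  (λ σ∈ → cyclePerms-complete {n} (perms-sound {n} σ∈)))
  (cycleSum-cyclePerms≤ x n)

-- Binomial estimates

nC0≡1 : ∀ n → n C 0 ≡ 1
nC0≡1 n = trans (nCk≡nC[n∸k] {k = 0} {n = n} z≤n) (nCn≡1 n)

nCk*k!*[n∸k]!≡n! : ∀ {n k} → k ≤ n → (n C k) * (k ! * (n ∸ k) !) ≡ n !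
nCk*k!*[n∸k]!≡n! {n} {k} k≤n =
  trans (cong (_* (k ! * (n ∸ k) !)) (nCk≡n!/k![n-k]! k≤n)) (m/n*n≡m (k![n∸k]!∣n! k≤n))
  where instance _ = k !* (n ∸ k) !≢0

[a+b]Ca*a!*b!≡[a+b]! : ∀ a b → ((a + b) C a) * (a ! * b !) ≡ (a + b) !
[a+b]Ca*a!*b!≡[a+b]! a b =
  subst (λ c → ((a + b) C a) * (a ! * c !) ≡ (a + b) !) (m+n∸m≡n a b)
        (nCk*k!*[n∸k]!≡n! (m≤m+n a b))

pascal : ∀ a b → (suc a + suc b) C suc a ≡ (a + suc b) C a + (suc a + b) C suc a
pascal a b = trans (sym (nCk+nC[k+1]≡[n+1]C[k+1] (a + suc b) a))
                   (cong (λ m → (a + suc b) C a + m C suc a) (+-suc a b))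

binomial-term≤ : ∀ x y a b → ((a + b) C a) * (x ^ a * y ^ b) ≤ (x + y) ^ (a + b)
binomial-term≤ x y zero b = begin
  (b C 0) * (1 * y ^ b)  ≡⟨ cong (_* (1 * y ^ b)) (nC0≡1 b) ⟩
  1 * (1 * y ^ b)        ≡⟨ *-identityˡ _ ⟩
  1 * y ^ b              ≡⟨ *-identityˡ _ ⟩
  y ^ b                  ≤⟨ ^-monoˡ-≤ b (m≤n+m y x) ⟩
  (x + y) ^ b            ∎
  where open ≤-Reasoning
binomial-term≤ x y (suc a) zero = begin
  ((suc a + 0) C suc a) * (x ^ suc a * 1)  ≡⟨ cong (λ m → (m C suc a) * (x ^ suc a * 1)) (+-identityʳ (suc a)) ⟩
  ((suc a) C suc a) * (x ^ suc a * 1)      ≡⟨ cong (_* (x ^ suc a * 1)) (nCn≡1 (suc a)) ⟩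
  1 * (x ^ suc a * 1)                      ≡⟨ trans (*-identityˡ _) (*-identityʳ _) ⟩
  x ^ suc a                                ≤⟨ ^-monoˡ-≤ (suc a) (m≤m+n x y) ⟩
  (x + y) ^ suc a                          ≡⟨ cong ((x + y) ^_) (+-identityʳ (suc a)) ⟨
  (x + y) ^ (suc a + 0)                    ∎
  where open ≤-Reasoning
binomial-term≤ x y (suc a) (suc b) = begin
  ((suc a + suc b) C suc a) * (x ^ suc a * y ^ suc b)
    ≡⟨ cong (_* (x ^ suc a * y ^ suc b)) (pascal a b) ⟩
  (c₁ + c₂) * ((x * x ^ a) * (y * y ^ b))
    ≡⟨ split c₁ c₂ x y (x ^ a) (y ^ b) ⟩
  x * (c₁ * (x ^ a * y ^ suc b)) + y * (c₂ * (x ^ suc a * y ^ b))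
    ≤⟨ +-mono-≤ (*-monoʳ-≤ x (binomial-term≤ x y a (suc b)))
                (*-monoʳ-≤ y (binomial-term≤ x y (suc a) b)) ⟩
  x * (x + y) ^ (a + suc b) + y * (x + y) ^ (suc a + b)
    ≡⟨ cong (λ m → x * (x + y) ^ m + y * (x + y) ^ (suc a + b)) (+-suc a b) ⟩
  x * (x + y) ^ (suc a + b) + y * (x + y) ^ (suc a + b)
    ≡⟨ *-distribʳ-+ ((x + y) ^ (suc a + b)) x y ⟨
  (x + y) ^ suc (suc a + b)
    ≡⟨ cong ((x + y) ^_) (+-suc (suc a) b) ⟨
  (x + y) ^ (suc a + suc b) ∎
  where
  open ≤-Reasoning
  c₁ = (a + suc b) C a
  c₂ = (suc a + b) C suc a
  split : ∀ c₁ c₂ x y X Y →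
          (c₁ + c₂) * ((x * X) * (y * Y)) ≡ x * (c₁ * (X * (y * Y))) + y * (c₂ * ((x * X) * Y))
  split = solve-∀

risingFactorial-suc*! : ∀ K n → risingFactorial (suc K) n * K ! ≡ (n + K) !
risingFactorial-suc*! K zero    = *-identityˡ (K !)
risingFactorial-suc*! K (suc n) = begin
  risingFactorial (suc K) n * suc (K + n) * K !
    ≡⟨ reorder (risingFactorial (suc K) n) (suc (K + n)) (K !) ⟩
  suc (K + n) * (risingFactorial (suc K) n * K !)
    ≡⟨ cong₂ (λ m r → suc m * r) (+-comm K n) (risingFactorial-suc*! K n) ⟩
  suc (n + K) * (n + K) ! ∎
  where
  open ≡-Reasoning
  reorder : ∀ r s f → r * s * f ≡ s * (r * f)
  reorder = solve-∀

risingFactorial-suc≡ : ∀ K n → risingFactorial (suc K) n ≡ n ! * ((n + K) C n)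
risingFactorial-suc≡ K n = *-cancelʳ-≡ _ _ (K !) {{K !≢0}} (begin
  risingFactorial (suc K) n * K !  ≡⟨ risingFactorial-suc*! K n ⟩
  (n + K) !                        ≡⟨ [a+b]Ca*a!*b!≡[a+b]! n K ⟨
  ((n + K) C n) * (n ! * K !)      ≡⟨ reorder ((n + K) C n) (n !) (K !) ⟩
  n ! * ((n + K) C n) * K !        ∎)
  where
  open ≡-Reasoning
  reorder : ∀ c a b → c * (a * b) ≡ a * c * b
  reorder = solve-∀

risingFactorial-suc*^≤ : ∀ K n →
  risingFactorial (suc K) n * (n ^ n * K ^ K) ≤ n ! * ((n + K) ^ n * (K + n) ^ K)
risingFactorial-suc*^≤ K n = begin
  risingFactorial (suc K) n * (n ^ n * K ^ K)    ≡⟨ cong (_* (n ^ n * K ^ K)) (risingFactorial-suc≡ K n) ⟩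
  n ! * ((n + K) C n) * (n ^ n * K ^ K)          ≡⟨ *-assoc (n !) _ _ ⟩
  n ! * (((n + K) C n) * (n ^ n * K ^ K))        ≤⟨ *-monoʳ-≤ (n !) (binomial-term≤ n K n K) ⟩
  n ! * (n + K) ^ (n + K)                        ≡⟨ cong (n ! *_) (^-distribˡ-+-* (n + K) n K) ⟩
  n ! * ((n + K) ^ n * (n + K) ^ K)              ≡⟨ cong (λ m → n ! * ((n + K) ^ n * m ^ K)) (+-comm n K) ⟩
  n ! * ((n + K) ^ n * (K + n) ^ K)              ∎
  where open ≤-Reasoning

risingFactorial-suc-weighted≤ : ∀ K M n →
  risingFactorial (suc K) n * (n ^ n * n ^ n * K ^ K * M ^ M)
    ≤ n ! * ((n + K) ^ n * (n + M) ^ n * (K + n) ^ K * (M + n) ^ M)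
risingFactorial-suc-weighted≤ K M n = begin
  risingFactorial (suc K) n * (n ^ n * n ^ n * K ^ K * M ^ M)
    ≡⟨ regroup (risingFactorial (suc K) n) (n ^ n) (K ^ K) (M ^ M) ⟩
  risingFactorial (suc K) n * (n ^ n * K ^ K) * (n ^ n * M ^ M)
    ≤⟨ *-mono-≤ (risingFactorial-suc*^≤ K n)
                (*-mono-≤ (^-monoˡ-≤ n (m≤m+n n M)) (^-monoˡ-≤ M (m≤m+n M n))) ⟩
  n ! * ((n + K) ^ n * (K + n) ^ K) * ((n + M) ^ n * (M + n) ^ M)
    ≡⟨ ungroup (n !) ((n + K) ^ n) ((K + n) ^ K) ((n + M) ^ n) ((M + n) ^ M) ⟩
  n ! * ((n + K) ^ n * (n + M) ^ n * (K + n) ^ K * (M + n) ^ M) ∎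
  where
  open ≤-Reasoning
  regroup : ∀ r a b c → r * (a * a * b * c) ≡ r * (a * b) * (a * c)
  regroup = solve-∀
  ungroup : ∀ f a b c d → f * (a * b) * (c * d) ≡ f * (a * c * b * d)
  ungroup = solve-∀

theorem4p6 : (n : ℕ) (λ' μ ν : List ℕ) →
    IsPartition n λ' → IsPartition n μ → IsPartition n ν →
    kroneckerSum n λ' μ ν *ℤ + (n ^ n * n ^ n * (len λ' * len μ * len ν) ^ (len λ' * len μ * len ν) * (len λ' * len μ) ^ (len λ' * len μ))
      ≤ℤ + (n ! * ((n + len λ' * len μ * len ν) ^ n * (n + len λ' * len μ) ^ n * (len λ' * len μ * len ν + n) ^ (len λ' * len μ * len ν) * (len λ' * len μ + n) ^ (len λ' * len μ)))
theorem4p6 n λ′ μ ν _ _ _ = begin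
  kroneckerSum n λ′ μ ν *ℤ + P        ≤⟨ ℤ.*-monoʳ-≤-nonNeg (+ P) (kroneckerSum≤cycleSum n λ′ μ ν) ⟩
  + cycleSum n (perms n) K *ℤ + P     ≡⟨ ℤ.pos-* (cycleSum n (perms n) K) P ⟨
  + (cycleSum n (perms n) K * P)      ≤⟨ +≤+ (*-monoˡ-≤ P cycleSum≤risingFactorial) ⟩
  + (risingFactorial (suc K) n * P)   ≤⟨ +≤+ (risingFactorial-suc-weighted≤ K M n) ⟩
  + (n ! * ((n + K) ^ n * (n + M) ^ n * (K + n) ^ K * (M + n) ^ M)) ∎
  where
  open ℤ.≤-Reasoning
  K = len λ′ * len μ * len ν
  M = len λ′ * len μ
  P = n ^ n * n ^ n * K ^ K * M ^ M
  cycleSum≤risingFactorial : cycleSum n (perms n) K ≤ risingFactorial (suc K) n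
  cycleSum≤risingFactorial = ≤-trans
    (sum-map-mono {xs = perms n} (λ {σ} _ → ^-monoˡ-≤ (cycleCount n σ) (n≤1+n K)))
    (cycleSum-perms≤ (suc K) n)
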